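{- A net is indexable iff all of its cycles are balanced.
   Context: A net is a finite graph-like object whose nodes are links and whose directed edges are labelled by formulas or $\flat$-formulas, together with a set of nested boxes. The links are: axiom (two conclusions $A^\bot,A$), cut (two premises $A,A^\bot$), one, bottom, tensor and par (premises $A,B$, conclusion $A\otimes B$, resp. $A\mathbin{⅋}B$), flat (premise $A$, conclusion $\flat A$), pax (premise and conclusion $\flat A$), why not (any number of premises $\flat A$, conclusion $?A$), of course (premise $A$, conclusion $!A$), paragraph (premise $A$, conclusion $\S A$). Each box has an of course link as principal port and pax links as auxiliary ports. Paths and cycles are those of the underlying undirected graph. An indexing is a function $I$ from edges to $\mathbb Z$ such that: the two conclusions of an axiom and the two premises of a cut have equal index; for one, bottom, tensor, par, flat, pax, why not and of course links, premises and conclusion have equal index; for a paragraph link with conclusion of index $i$ the premise has index $i+1$. A net is indexable if it admits an indexing. For a path (or cycle), let $n^+$ (resp. $n^-$) be the number of times it traverses a paragraph link from premise to conclusion (resp. from conclusion to premise); its balance is $|n^+-n^-|$, and it is balanced if its balance is $0$. -}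

module Defs where

open import Data.Nat using (ℕ; zero; suc; _+_; _≤_)
open import Data.Integer as ℤ using (ℤ)
open import Data.Fin using (Fin; _≟_)
open import Data.Fin.Subset as Sub using (Subset)
open import Data.List using (List; []; _∷_; length; filter; concatMap; map; allFin)
open import Data.List.Membership.Propositional using (_∈_)
open import Data.List.Relation.Unary.All using (All)
open import Data.List.Relation.Unary.Unique.Propositional using (Unique)
open import Data.Product using (Σ; ∃; ∃-syntax; _×_)
open import Data.Sum using (_⊎_)
open import Relation.Binary.PropositionalEquality using (_≡_)
import Data.Unit

data Formula : Set where
  atom  : ℕ → Formula
  natom : ℕ → Formula
  𝟏 ⊥'  : Formula
  _⊗_ _⅋_ : Formula → Formula → Formula
  ‼_ ⁇_ §_ : Formula → Formula

_ᗮ : Formula → Formula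
atom n ᗮ  = natom n
natom n ᗮ = atom n
𝟏 ᗮ       = ⊥'
⊥' ᗮ      = 𝟏
(A ⊗ B) ᗮ = (A ᗮ) ⅋ (B ᗮ)
(A ⅋ B) ᗮ = (A ᗮ) ⊗ (B ᗮ)
(‼ A) ᗮ   = ⁇ (A ᗮ)
(⁇ A) ᗮ   = ‼ (A ᗮ)
(§ A) ᗮ   = § (A ᗮ)

data Label : Set where
  fml : Formula → Label
  ♭   : Formula → Label

-- Links, over a type E of edges.  Arguments: premises first, then
-- conclusions.

data LinkKind : Set where
  axK cutK oneK botK tensorK parK flatK paxK whynotK ofcourseK paraK : LinkKind

data Link (E : Set) : Set where
  ax       : E → E → Link E
  cut      : E → E → Link E
  one      : E → Link E
  bot      : E → Link E
  tensor   : E → E → E → Link E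
  par      : E → E → E → Link E
  flat     : E → E → Link E
  pax      : E → E → Link E
  whynot   : List E → E → Link E
  ofcourse : E → E → Link E
  para     : E → E → Link E

module _ {E : Set} where

  kindOf : Link E → LinkKind
  kindOf (ax _ _)         = axK
  kindOf (cut _ _)        = cutK
  kindOf (one _)          = oneK
  kindOf (bot _)          = botK
  kindOf (tensor _ _ _)   = tensorK
  kindOf (par _ _ _)      = parK
  kindOf (flat _ _)       = flatK
  kindOf (pax _ _)        = paxK
  kindOf (whynot _ _)     = whynotK
  kindOf (ofcourse _ _)   = ofcourseK
  kindOf (para _ _)       = paraK

  premises : Link E → List E
  premises (ax _ _)       = []
  premises (cut a b)      = a ∷ b ∷ []
  premises (one _)        = []
  premises (bot _)        = []
  premises (tensor a b _) = a ∷ b ∷ []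
  premises (par a b _)    = a ∷ b ∷ []
  premises (flat a _)     = a ∷ []
  premises (pax a _)      = a ∷ []
  premises (whynot ps _)  = ps
  premises (ofcourse a _) = a ∷ []
  premises (para a _)     = a ∷ []

  conclusions : Link E → List E
  conclusions (ax a b)       = a ∷ b ∷ []
  conclusions (cut _ _)      = []
  conclusions (one c)        = c ∷ []
  conclusions (bot c)        = c ∷ []
  conclusions (tensor _ _ c) = c ∷ []
  conclusions (par _ _ c)    = c ∷ []
  conclusions (flat _ c)     = c ∷ []
  conclusions (pax _ c)      = c ∷ []
  conclusions (whynot _ c)   = c ∷ []
  conclusions (ofcourse _ c) = c ∷ []
  conclusions (para _ c)     = c ∷ []

  WellLabelled : (E → Label) → Link E → Set
  WellLabelled lab (ax a b)       = ∃[ A ] (lab a ≡ fml (A ᗮ) × lab b ≡ fml A)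
  WellLabelled lab (cut a b)      = ∃[ A ] (lab a ≡ fml A × lab b ≡ fml (A ᗮ))
  WellLabelled lab (one c)        = lab c ≡ fml 𝟏
  WellLabelled lab (bot c)        = lab c ≡ fml ⊥'
  WellLabelled lab (tensor a b c) = ∃[ A ] ∃[ B ] (lab a ≡ fml A × lab b ≡ fml B × lab c ≡ fml (A ⊗ B))
  WellLabelled lab (par a b c)    = ∃[ A ] ∃[ B ] (lab a ≡ fml A × lab b ≡ fml B × lab c ≡ fml (A ⅋ B))
  WellLabelled lab (flat a c)     = ∃[ A ] (lab a ≡ fml A × lab c ≡ ♭ A)
  WellLabelled lab (pax a c)      = ∃[ A ] (lab a ≡ ♭ A × lab c ≡ ♭ A)
  WellLabelled lab (whynot ps c)  = ∃[ A ] (All (λ p → lab p ≡ ♭ A) ps × lab c ≡ fml (⁇ A))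
  WellLabelled lab (ofcourse a c) = ∃[ A ] (lab a ≡ fml A × lab c ≡ fml (‼ A))
  WellLabelled lab (para a c)     = ∃[ A ] (lab a ≡ fml A × lab c ≡ fml (§ A))

occ : ∀ {n} → Fin n → List (Fin n) → ℕ
occ x xs = length (filter (x ≟_) xs)

record Net : Set where
  field
    nLinks nEdges nBoxes : ℕ
    link  : Fin nLinks → Link (Fin nEdges)
    label : Fin nEdges → Label
    wellLabelled : ∀ l → WellLabelled label (link l)
    -- every edge is the conclusion of exactly one link (and exactly once),
    -- and the premise of at most one link; edges which are premises of
    -- no link are the conclusions of the net.
    conclOnce : ∀ e → occ e (concatMap (λ l → conclusions (link l)) (allFin nLinks)) ≡ 1
    premAtMostOnce : ∀ e → occ e (concatMap (λ l → premises (link l)) (allFin nLinks)) ≤ 1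
    principal : Fin nBoxes → Fin nLinks
    auxiliary : Fin nBoxes → List (Fin nLinks)
    content   : Fin nBoxes → Subset nLinks
    principalOfCourse : ∀ b → kindOf (link (principal b)) ≡ ofcourseK
    auxiliaryPax      : ∀ b → All (λ l → kindOf (link l) ≡ paxK) (auxiliary b)
    principalInside   : ∀ b → principal b Sub.∈ content b
    auxiliaryInside   : ∀ b → All (Sub._∈ content b) (auxiliary b)
    nested : ∀ b b' → (content b Sub.⊆ content b') ⊎ (content b' Sub.⊆ content b)
                      ⊎ Sub.Empty (content b Sub.∩ content b')

module _ (N : Net) where
  open Net N

  IndexCond : (Fin nEdges → ℤ) → Link (Fin nEdges) → Set
  IndexCond I (ax a b)       = I a ≡ I b
  IndexCond I (cut a b)      = I a ≡ I b
  IndexCond I (one c)        = Data.Unit.⊤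
  IndexCond I (bot c)        = Data.Unit.⊤
  IndexCond I (tensor a b c) = I a ≡ I c × I b ≡ I c
  IndexCond I (par a b c)    = I a ≡ I c × I b ≡ I c
  IndexCond I (flat a c)     = I a ≡ I c
  IndexCond I (pax a c)      = I a ≡ I c
  IndexCond I (whynot ps c)  = All (λ p → I p ≡ I c) ps
  IndexCond I (ofcourse a c) = I a ≡ I c
  IndexCond I (para a c)     = I a ≡ I c ℤ.+ ℤ.1ℤ

  IsIndexing : (Fin nEdges → ℤ) → Set
  IsIndexing I = ∀ l → IndexCond I (link l)

  Indexable : Set
  Indexable = ∃[ I ] IsIndexing I

-- Paths and cycles of the underlying undirected graph (nodes = links,
-- an edge joins the link of which it is a conclusion to the link of
-- which it is a premise; pending edges join nothing).

  data Dir : Set where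
    down up : Dir

  data Step : Fin nLinks → Fin nLinks → Set where
    stepDown : ∀ {l l'} (e : Fin nEdges) → e ∈ conclusions (link l) → e ∈ premises (link l') → Step l l'
    stepUp   : ∀ {l l'} (e : Fin nEdges) → e ∈ premises (link l) → e ∈ conclusions (link l') → Step l l'

  stepEdge : ∀ {l l'} → Step l l' → Fin nEdges
  stepEdge (stepDown e _ _) = e
  stepEdge (stepUp e _ _)   = e

  stepDir : ∀ {l l'} → Step l l' → Dir
  stepDir (stepDown _ _ _) = down
  stepDir (stepUp _ _ _)   = up

  data Walk : Fin nLinks → Fin nLinks → Set where
    []  : ∀ {l} → Walk l l
    _∷_ : ∀ {l m r} → Step l m → Walk m r → Walk l r

  walkEdges : ∀ {l r} → Walk l r → List (Fin nEdges)
  walkEdges []      = []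
  walkEdges (s ∷ w) = stepEdge s ∷ walkEdges w

  record Cycle : Set where
    constructor cycle
    field
      {base next} : Fin nLinks
      first    : Step base next
      rest     : Walk next base
      distinct : Unique (walkEdges (first ∷ rest))

  -- Traversing link m, arriving by a step of direction d and leaving by
  -- a step of direction d'.  Arriving downwards means arriving through a
  -- premise of m; leaving downwards means leaving through a conclusion.
  -- For a paragraph link: premise→conclusion is (down, down),
  -- conclusion→premise is (up, up).
  plusAt : Fin nLinks → Dir → Dir → ℕ
  plusAt m d d' with kindOf (link m) | d | d'
  ... | paraK | down | down = 1
  ... | _     | _    | _    = 0

  minusAt : Fin nLinks → Dir → Dir → ℕ
  minusAt m d d' with kindOf (link m) | d | d'
  ... | paraK | up | up = 1
  ... | _     | _  | _  = 0

  -- count the traversals along a walk from m to the base, where d is the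
  -- direction of the step by which m was reached, and d₀ the direction of
  -- the first step of the cycle (leaving the base).
  countWalk : (Fin nLinks → Dir → Dir → ℕ) → ∀ {m b} → Dir → Walk m b → Dir → ℕ
  countWalk f {m} d []      d₀ = f m d d₀
  countWalk f {m} d (s ∷ w) d₀ = f m d (stepDir s) + countWalk f (stepDir s) w d₀

  nPlus : Cycle → ℕ
  nPlus (cycle s w _) = countWalk plusAt (stepDir s) w (stepDir s)

  nMinus : Cycle → ℕ
  nMinus (cycle s w _) = countWalk minusAt (stepDir s) w (stepDir s)

  Balanced : Cycle → Set
  Balanced c = nPlus c ≡ nMinus c

-- Give each link a level, the index of its conclusions (its premises sit one higher for a
-- paragraph link), and weigh each step of the underlying graph by the change of level it forces.
-- Counting the paragraph traversals link by link shows that n⁻ − n⁺ of a cycle is its total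
-- weight.  An indexing yields levels forming a potential for these weights, so every cycle has
-- weight 0.  Conversely, if every cycle has weight 0, a potential is built by adding the edges one
-- at a time while tracking components: an edge inside a component closes a cycle, hence is
-- already consistent, and an edge between two components is made consistent by shifting one of
-- them.  Indexing each edge by the level of the link it is a conclusion of then works.
module Submission where

open import Defs
open import Function.Bundles using (_⇔_; mk⇔; Equivalence)
open import Function.Base using (_∘_)
open import Algebra.Properties.AbelianGroup using (identityʳ-unique)
open import Data.Nat as ℕ using (ℕ; _≤_)
import Data.Nat.Properties as ℕₚ
open import Data.Integer as ℤ using (ℤ; +_; 0ℤ; 1ℤ; _+_; _-_)
import Data.Integer.Properties as ℤₚ
open import Data.Integer.Tactic.RingSolver using (solve-∀)
open import Data.Fin using (Fin; _≟_)
open import Data.Fin.Properties using (any?)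
open import Data.List using (List; []; _∷_; _++_; concatMap; filter; length; allFin)
import Data.List.Properties as Listₚ
open import Data.List.Membership.Propositional using (_∈_; _∉_; lose)
open import Data.List.Membership.Propositional.Properties
  using (∈-filter⁺; ∈-concatMap⁺; ∈-concatMap⁻; ∈-allFin)
open import Data.List.Relation.Unary.Any using (here; there; satisfied)
open import Data.List.Relation.Unary.All as All using (All; []; _∷_)
open import Data.List.Relation.Unary.All.Properties using (++⁺)
open import Data.List.Relation.Unary.AllPairs using ([]; _∷_)
open import Data.List.Relation.Unary.Unique.Propositional using (Unique)
import Data.List.Relation.Unary.Unique.Propositional.Properties as Uniqueₚ
open import Data.List.Relation.Binary.Disjoint.Propositional using (Disjoint)
open import Data.Product using (∃; _×_; _,_; proj₁; proj₂)
open import Data.Unit using (tt)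
open import Relation.Nullary using (yes; no; ¬_; contradiction)
open import Relation.Binary.PropositionalEquality

module _ {n : ℕ} where

  occ-++ : ∀ (x : Fin n) xs ys → occ x (xs ++ ys) ≡ occ x xs ℕ.+ occ x ys
  occ-++ x xs ys =
    trans (cong length (Listₚ.filter-++ (x ≟_) xs ys)) (Listₚ.length-++ (filter (x ≟_) xs))

  ∈⇒1≤occ : ∀ {x : Fin n} {xs} → x ∈ xs → 1 ≤ occ x xs
  ∈⇒1≤occ {x} x∈xs = nonEmpty (∈-filter⁺ (x ≟_) x∈xs refl)
    where
    nonEmpty : ∀ {y : Fin n} {ys} → y ∈ ys → 1 ≤ length ys
    nonEmpty (here _)  = ℕ.s≤s ℕ.z≤n
    nonEmpty (there _) = ℕ.s≤s ℕ.z≤n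

  occ≡1⇒∈ : ∀ {x : Fin n} xs → occ x xs ≡ 1 → x ∈ xs
  occ≡1⇒∈ {x} (y ∷ ys) h with x ≟ y
  ... | yes refl = here refl
  ... | no _     = there (occ≡1⇒∈ ys h)

  occ≤1-++⇒∉ : ∀ {x : Fin n} xs {ys} → occ x (xs ++ ys) ≤ 1 → x ∈ xs → x ∉ ys
  occ≤1-++⇒∉ {x} xs {ys} h x∈xs x∈ys = ℕₚ.<-irrefl refl (begin
    1 ℕ.+ 1               ≤⟨ ℕₚ.+-mono-≤ (∈⇒1≤occ x∈xs) (∈⇒1≤occ x∈ys) ⟩
    occ x xs ℕ.+ occ x ys ≡⟨ occ-++ x xs ys ⟨
    occ x (xs ++ ys)      ≤⟨ h ⟩
    1                     ∎)
    where open ℕₚ.≤-Reasoning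

  occ≤1-++ʳ : ∀ {x : Fin n} xs {ys} → occ x (xs ++ ys) ≤ 1 → occ x ys ≤ 1
  occ≤1-++ʳ {x} xs {ys} h =
    ℕₚ.≤-trans (ℕₚ.m≤n+m _ (occ x xs)) (subst (_≤ 1) (occ-++ x xs ys) h)

  occ≤1-concatMap⇒unique : ∀ {m} (f : Fin m → List (Fin n)) {x l l'} ys →
    occ x (concatMap f ys) ≤ 1 → l ∈ ys → l' ∈ ys → x ∈ f l → x ∈ f l' → l ≡ l'
  occ≤1-concatMap⇒unique f (y ∷ ys) h (here refl) (here refl) _ _ = refl
  occ≤1-concatMap⇒unique f (y ∷ ys) h (here refl) (there q) x∈fy x∈fl' =
    contradiction (∈-concatMap⁺ f (lose q x∈fl')) (occ≤1-++⇒∉ (f y) h x∈fy)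
  occ≤1-concatMap⇒unique f (y ∷ ys) h (there p) (here refl) x∈fl x∈fy =
    contradiction (∈-concatMap⁺ f (lose p x∈fl)) (occ≤1-++⇒∉ (f y) h x∈fy)
  occ≤1-concatMap⇒unique f (y ∷ ys) h (there p) (there q) x∈fl x∈fl' =
    occ≤1-concatMap⇒unique f ys (occ≤1-++ʳ (f y) h) p q x∈fl x∈fl'

reverse-difference : ∀ {a b} x y → b ≡ a + (x - y) → a ≡ b + (y - x)
reverse-difference {a} x y refl = identity a x y
  where identity : ∀ a x y → a ≡ (a + (x - y)) + (y - x)
        identity = solve-∀

≡⇒≡+0 : ∀ {x y} → x ≡ y → x ≡ y + 0ℤ
≡⇒≡+0 x≡y = trans x≡y (sym (ℤₚ.+-identityʳ _))

∉⇒All≢ : ∀ {A : Set} {x : A} {xs ys} → x ∉ xs → All (_∈ xs) ys → All (x ≢_) ys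
∉⇒All≢ {xs = xs} x∉xs = All.map (λ y∈xs x≡y → x∉xs (subst (_∈ xs) (sym x≡y) y∈xs))

module _ (N : Net) where
  open Net N

  conclusionOf : ∀ e → ∃ λ l → e ∈ conclusions (link l)
  conclusionOf e =
    satisfied (∈-concatMap⁻ (λ l → conclusions (link l)) {allFin nLinks} (occ≡1⇒∈ _ (conclOnce e)))

  source : Fin nEdges → Fin nLinks
  source e = proj₁ (conclusionOf e)

  source-conclusion : ∀ e → e ∈ conclusions (link (source e))
  source-conclusion e = proj₂ (conclusionOf e)

  source-unique : ∀ {e l} → e ∈ conclusions (link l) → l ≡ source e
  source-unique {e} {l} e∈l =
    occ≤1-concatMap⇒unique (λ l → conclusions (link l)) (allFin nLinks)
      (ℕₚ.≤-reflexive (conclOnce e)) (∈-allFin l) (∈-allFin (source e)) e∈l (source-conclusion e)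

  premise-unique : ∀ {e l l'} → e ∈ premises (link l) → e ∈ premises (link l') → l ≡ l'
  premise-unique {e} {l} {l'} =
    occ≤1-concatMap⇒unique (λ l → premises (link l)) (allFin nLinks)
      (premAtMostOnce e) (∈-allFin l) (∈-allFin l')

  flip : Dir N → Dir N
  flip down = up
  flip up   = down

  ports : Link (Fin nEdges) → Dir N → List (Fin nEdges)
  ports L down = conclusions L
  ports L up   = premises L

  step-ports : ∀ {l l'} (s : Step N l l') →
    stepEdge N s ∈ ports (link l) (stepDir N s) × stepEdge N s ∈ ports (link l') (flip (stepDir N s))
  step-ports (stepDown _ e∈l e∈l') = e∈l , e∈l'
  step-ports (stepUp _ e∈l e∈l')   = e∈l , e∈l'

  step-premise : ∀ {l l'} (s : Step N l l') → ∃ λ m → stepEdge N s ∈ premises (link m)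
  step-premise {l' = l'} (stepDown _ _ e∈l') = l' , e∈l'
  step-premise {l}       (stepUp _ e∈l _)    = l , e∈l

module PortWeighting (N : Net) (w : Fin (Net.nLinks N) → Dir N → ℤ) where
  open Net N

  stepWeight : ∀ {l l'} → Step N l l' → ℤ
  stepWeight {l} {l'} s = w l (stepDir N s) - w l' (flip N (stepDir N s))

  walkWeight : ∀ {l l'} → Walk N l l' → ℤ
  walkWeight []      = 0ℤ
  walkWeight (s ∷ p) = stepWeight s + walkWeight p

  cycleWeight : Cycle N → ℤ
  cycleWeight (cycle s p _) = walkWeight (s ∷ p)

  Consistent : (Fin nLinks → ℤ) → Fin nLinks → Fin nLinks → Dir N → Set
  Consistent P l l' d = P l' ≡ P l + (w l d - w l' (flip N d))

  IsPotential : (Fin nLinks → ℤ) → Set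
  IsPotential P = ∀ {l l'} (s : Step N l l') → Consistent P l l' (stepDir N s)

  consistent-flip : ∀ {P l l'} d → Consistent P l l' d → Consistent P l' l (flip N d)
  consistent-flip {l = l} {l'} down = reverse-difference (w l down) (w l' up)
  consistent-flip {l = l} {l'} up   = reverse-difference (w l up) (w l' down)

  walkWeight-telescopes : ∀ {P} → IsPotential P → ∀ {l l'} (p : Walk N l l') → P l' ≡ P l + walkWeight p
  walkWeight-telescopes {P} potential {l} [] = sym (ℤₚ.+-identityʳ (P l))
  walkWeight-telescopes {P} potential {l} (_∷_ {m = m} s p) = begin
    P _                                 ≡⟨ walkWeight-telescopes potential p ⟩
    P m + walkWeight p                  ≡⟨ cong (_+ walkWeight p) (potential s) ⟩
    (P l + stepWeight s) + walkWeight p ≡⟨ ℤₚ.+-assoc (P l) (stepWeight s) (walkWeight p) ⟩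
    P l + walkWeight (s ∷ p)            ∎
    where open ≡-Reasoning

  potential⇒cycleWeight≡0 : ∀ {P} → IsPotential P → (c : Cycle N) → cycleWeight c ≡ 0ℤ
  potential⇒cycleWeight≡0 {P} potential (cycle {base} s p _) =
    identityʳ-unique ℤₚ.+-0-abelianGroup (P base) _ (sym (walkWeight-telescopes potential (s ∷ p)))

  _++ʷ_ : ∀ {x y z} → Walk N x y → Walk N y z → Walk N x z
  []      ++ʷ q = q
  (s ∷ p) ++ʷ q = s ∷ (p ++ʷ q)

  walkEdges-++ʷ : ∀ {x y z} (p : Walk N x y) (q : Walk N y z) →
    walkEdges N (p ++ʷ q) ≡ walkEdges N p ++ walkEdges N q
  walkEdges-++ʷ []      q = refl
  walkEdges-++ʷ (s ∷ p) q = cong (stepEdge N s ∷_) (walkEdges-++ʷ p q)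

  walkWeight-++ʷ : ∀ {x y z} (p : Walk N x y) (q : Walk N y z) →
    walkWeight (p ++ʷ q) ≡ walkWeight p + walkWeight q
  walkWeight-++ʷ []      q = sym (ℤₚ.+-identityˡ (walkWeight q))
  walkWeight-++ʷ (s ∷ p) q = begin
    stepWeight s + walkWeight (p ++ʷ q)             ≡⟨ cong (λ z → stepWeight s + z) (walkWeight-++ʷ p q) ⟩
    stepWeight s + (walkWeight p + walkWeight q)    ≡⟨ ℤₚ.+-assoc (stepWeight s) _ _ ⟨
    walkWeight (s ∷ p) + walkWeight q               ∎
    where open ≡-Reasoning

  record Trail (es : List (Fin nEdges)) (P : Fin nLinks → ℤ) (x y : Fin nLinks) : Set where
    constructor trail
    field
      walk      : Walk N x y
      distinct  : Unique (walkEdges N walk)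
      within    : All (_∈ es) (walkEdges N walk)
      telescope : P y ≡ P x + walkWeight walk

  trail-weaken : ∀ {e es P x y} → Trail es P x y → Trail (e ∷ es) P x y
  trail-weaken (trail p distinct within telescope) = trail p distinct (All.map there within) telescope

  trail-lift : ∀ {es P x y} (b : Fin nLinks → ℤ) → Trail es P x y → b x ≡ b y →
    Trail es (λ z → P z + b z) x y
  trail-lift {P = P} {x} {y} b (trail p distinct within telescope) bx≡by =
    trail p distinct within (begin
      P y + b y                    ≡⟨ cong₂ _+_ telescope (sym bx≡by) ⟩
      (P x + walkWeight p) + b x   ≡⟨ identity (P x) (walkWeight p) (b x) ⟩
      (P x + b x) + walkWeight p   ∎)
    where
    open ≡-Reasoning
    identity : ∀ a W β → (a + W) + β ≡ (a + β) + W
    identity = solve-∀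

  module Components {es} (root : Fin nLinks → Fin nLinks)
    (root-step : ∀ {l l'} (s : Step N l l') → stepEdge N s ∈ es → root l ≡ root l') where

    source-root : ∀ {x y} (p : Walk N x y) → All (_∈ es) (walkEdges N p) →
      ∀ {f} → f ∈ walkEdges N p → root (source N f) ≡ root x
    source-root (stepDown _ f∈x _ ∷ _) _ (here refl) = cong root (sym (source-unique N f∈x))
    source-root (s@(stepUp _ _ f∈y) ∷ _) (s∈es ∷ _) (here refl) =
      trans (cong root (sym (source-unique N f∈y))) (sym (root-step s s∈es))
    source-root (s ∷ p) (s∈es ∷ within) (there f∈p) =
      trans (source-root p within f∈p) (sym (root-step s s∈es))

    -- Trails inside two different components have disjoint edges, so they can be joined by a fresh step.
    trail-bridge : ∀ {P x a b y} (s : Step N a b) → stepEdge N s ∉ es →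
      Trail es P x a → Consistent P a b (stepDir N s) → Trail es P b y →
      root x ≡ root a → root a ≢ root b → Trail (stepEdge N s ∷ es) P x y
    trail-bridge {P} {x} {a} {b} {y} s e∉es (trail p₁ distinct₁ within₁ telescope₁) step
                 (trail p₂ distinct₂ within₂ telescope₂) x~a a≁b =
      trail (p₁ ++ʷ (s ∷ p₂)) distinct within telescope
      where
      e = stepEdge N s

      disjoint : Disjoint (walkEdges N p₁) (e ∷ walkEdges N p₂)
      disjoint (f∈p₁ , here refl)  = e∉es (All.lookup within₁ f∈p₁)
      disjoint (f∈p₁ , there f∈p₂) =
        a≁b (trans (sym x~a) (trans (sym (source-root p₁ within₁ f∈p₁)) (source-root p₂ within₂ f∈p₂)))

      distinct : Unique (walkEdges N (p₁ ++ʷ (s ∷ p₂)))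
      distinct = subst Unique (sym (walkEdges-++ʷ p₁ (s ∷ p₂)))
        (Uniqueₚ.++⁺ distinct₁ (∉⇒All≢ e∉es within₂ ∷ distinct₂) disjoint)

      within : All (_∈ e ∷ es) (walkEdges N (p₁ ++ʷ (s ∷ p₂)))
      within = subst (All (_∈ e ∷ es)) (sym (walkEdges-++ʷ p₁ (s ∷ p₂)))
        (++⁺ (All.map there within₁) (here refl ∷ All.map there within₂))

      telescope : P y ≡ P x + walkWeight (p₁ ++ʷ (s ∷ p₂))
      telescope = begin
        P y
          ≡⟨ telescope₂ ⟩
        P b + walkWeight p₂
          ≡⟨ cong (_+ walkWeight p₂) step ⟩
        (P a + stepWeight s) + walkWeight p₂
          ≡⟨ cong (λ z → (z + stepWeight s) + walkWeight p₂) telescope₁ ⟩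
        ((P x + walkWeight p₁) + stepWeight s) + walkWeight p₂
          ≡⟨ identity (P x) (walkWeight p₁) (stepWeight s) (walkWeight p₂) ⟩
        P x + (walkWeight p₁ + walkWeight (s ∷ p₂))
          ≡⟨ cong (λ z → P x + z) (walkWeight-++ʷ p₁ (s ∷ p₂)) ⟨
        P x + walkWeight (p₁ ++ʷ (s ∷ p₂))
          ∎
        where
        open ≡-Reasoning
        identity : ∀ a W₁ σ W₂ → ((a + W₁) + σ) + W₂ ≡ a + (W₁ + (σ + W₂))
        identity = solve-∀

  record PartialPotential (es : List (Fin nEdges)) : Set where
    field
      potential      : Fin nLinks → ℤ
      root           : Fin nLinks → Fin nLinks
      potential-step : ∀ {l l'} (s : Step N l l') → stepEdge N s ∈ es →
                       Consistent potential l l' (stepDir N s)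
      root-step      : ∀ {l l'} (s : Step N l l') → stepEdge N s ∈ es → root l ≡ root l'
      connect        : ∀ x y → root x ≡ root y → Trail es potential x y

  noEdges : PartialPotential []
  noEdges = record
    { potential      = λ _ → 0ℤ
    ; root           = λ x → x
    ; potential-step = λ _ ()
    ; root-step      = λ _ ()
    ; connect        = λ { x .x refl → trail [] [] [] refl }
    }

  module Extend (zeroCycles : ∀ c → cycleWeight c ≡ 0ℤ)
    {e es} (e∉es : e ∉ es) (pp : PartialPotential es) where
    open PartialPotential pp
    open Components root root-step

    pending : ¬ (∃ λ t → e ∈ premises (link t)) → PartialPotential (e ∷ es)
    pending noPremise = record
      { potential      = potential
      ; root           = root
      ; potential-step = λ s → old s (potential-step s)
      ; root-step      = λ s → old s (root-step s)
      ; connect        = λ x y r → trail-weaken (connect x y r)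
      }
      where
      old : ∀ {l l'} {A : Set} (s : Step N l l') → (stepEdge N s ∈ es → A) → stepEdge N s ∈ e ∷ es → A
      old s onOld (here s≡e)  = contradiction (subst (λ f → ∃ λ t → f ∈ premises (link t)) s≡e (step-premise N s)) noPremise
      old s onOld (there s∈es) = onOld s∈es

    module _ {t} (e∈t : e ∈ premises (link t)) where
      c₀ : Fin nLinks
      c₀ = source N e

      s↓ : Step N c₀ t
      s↓ = stepDown e (source-conclusion N e) e∈t

      s↑ : Step N t c₀
      s↑ = stepUp e e∈t (source-conclusion N e)

      extendAlong : (Q : Fin nLinks → Fin nLinks → Dir N → Set) →
        (∀ {l l'} (s : Step N l l') → stepEdge N s ∈ es → Q l l' (stepDir N s)) →
        Q c₀ t down → Q t c₀ up →
        ∀ {l l'} (s : Step N l l') → stepEdge N s ∈ e ∷ es → Q l l' (stepDir N s)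
      extendAlong Q onOld q↓ q↑ s (there s∈es) = onOld s s∈es
      extendAlong Q onOld q↓ q↑ (stepDown _ f∈l f∈l') (here refl)
        with source-unique N f∈l | premise-unique N f∈l' e∈t
      ... | refl | refl = q↓
      extendAlong Q onOld q↓ q↑ (stepUp _ f∈l f∈l') (here refl)
        with premise-unique N f∈l e∈t | source-unique N f∈l'
      ... | refl | refl = q↑

      extendConsistent : ∀ {P} →
        (∀ {l l'} (s : Step N l l') → stepEdge N s ∈ es → Consistent P l l' (stepDir N s)) →
        Consistent P c₀ t down →
        ∀ {l l'} (s : Step N l l') → stepEdge N s ∈ e ∷ es → Consistent P l l' (stepDir N s)
      extendConsistent {P} onOld q↓ = extendAlong (Consistent P) onOld q↓ (consistent-flip {P} {c₀} {t} down q↓)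

      extendRoot : ∀ {r : Fin nLinks → Fin nLinks} →
        (∀ {l l'} (s : Step N l l') → stepEdge N s ∈ es → r l ≡ r l') → r c₀ ≡ r t →
        ∀ {l l'} (s : Step N l l') → stepEdge N s ∈ e ∷ es → r l ≡ r l'
      extendRoot {r} onOld c₀~t = extendAlong (λ l l' _ → r l ≡ r l') onOld c₀~t (sym c₀~t)

      closing : root c₀ ≡ root t → PartialPotential (e ∷ es)
      closing c₀~t = record
        { potential      = potential
        ; root           = root
        ; potential-step = extendConsistent potential-step closes
        ; root-step      = extendRoot root-step c₀~t
        ; connect        = λ x y r → trail-weaken (connect x y r)
        }
        where
        cancel : ∀ {a b} W σ → b ≡ a + W → σ + W ≡ 0ℤ → a ≡ b + σ
        cancel {a} W σ refl σ+W≡0 = begin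
          a             ≡⟨ ℤₚ.+-identityʳ a ⟨
          a + 0ℤ        ≡⟨ cong (λ z → a + z) σ+W≡0 ⟨
          a + (σ + W)   ≡⟨ identity a W σ ⟩
          (a + W) + σ   ∎
          where
          open ≡-Reasoning
          identity : ∀ a W σ → a + (σ + W) ≡ (a + W) + σ
          identity = solve-∀

        -- s↓ followed by a trail back from t to c₀ is a cycle.
        closes : Consistent potential c₀ t down
        closes with connect t c₀ (sym c₀~t)
        ... | trail p distinct within telescope =
          cancel (walkWeight p) (stepWeight s↓) telescope
            (zeroCycles (cycle s↓ p (∉⇒All≢ e∉es within ∷ distinct)))

      -- The component of t is shifted by δ, which makes s↓ consistent, and merged into that of c₀.
      module Merge (c₀≁t : root c₀ ≢ root t) where
        ifMoved : ∀ {A : Set} → Fin nLinks → A → A → A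
        ifMoved r a b with r ≟ root t
        ... | yes _ = a
        ... | no  _ = b

        ifMoved-t : ∀ {A : Set} {a b : A} → ifMoved (root t) a b ≡ a
        ifMoved-t with root t ≟ root t
        ... | yes _  = refl
        ... | no t≁t = contradiction refl t≁t

        ifMoved-c₀ : ∀ {A : Set} {a b : A} → ifMoved (root c₀) a b ≡ b
        ifMoved-c₀ with root c₀ ≟ root t
        ... | yes c₀~t = contradiction c₀~t c₀≁t
        ... | no _     = refl

        δ : ℤ
        δ = (potential c₀ + stepWeight s↓) - potential t

        lift : Fin nLinks → ℤ
        lift r = ifMoved r δ 0ℤ

        potential′ : Fin nLinks → ℤ
        potential′ x = potential x + lift (root x)

        root′ : Fin nLinks → Fin nLinks
        root′ x = ifMoved (root x) (root c₀) (root x)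

        shifted-step : ∀ {l l'} (s : Step N l l') → stepEdge N s ∈ es →
          Consistent potential′ l l' (stepDir N s)
        shifted-step {l} {l'} s s∈es = begin
          potential l' + lift (root l')                ≡⟨ cong₂ _+_ (potential-step s s∈es) (cong lift (sym (root-step s s∈es))) ⟩
          (potential l + stepWeight s) + lift (root l) ≡⟨ identity (potential l) (stepWeight s) (lift (root l)) ⟩
          potential′ l + stepWeight s                  ∎
          where
          open ≡-Reasoning
          identity : ∀ a σ β → (a + σ) + β ≡ (a + β) + σ
          identity = solve-∀

        relabelled-step : ∀ {l l'} (s : Step N l l') → stepEdge N s ∈ es → root′ l ≡ root′ l'
        relabelled-step s s∈es = cong (λ r → ifMoved r (root c₀) r) (root-step s s∈es)

        merged↓ : Consistent potential′ c₀ t down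
        merged↓ = begin
          potential t + lift (root t)          ≡⟨ cong (λ z → potential t + z) ifMoved-t ⟩
          potential t + δ                      ≡⟨ identity (potential t) (potential c₀) (stepWeight s↓) ⟩
          (potential c₀ + 0ℤ) + stepWeight s↓  ≡⟨ cong (λ z → (potential c₀ + z) + stepWeight s↓) ifMoved-c₀ ⟨
          potential′ c₀ + stepWeight s↓        ∎
          where
          open ≡-Reasoning
          identity : ∀ a b σ → a + ((b + σ) - a) ≡ (b + 0ℤ) + σ
          identity = solve-∀

        merged↑ : Consistent potential′ t c₀ up
        merged↑ = consistent-flip {potential′} {c₀} {t} down merged↓

        lifted : ∀ x y → root x ≡ root y → Trail es potential′ x y
        lifted x y r = trail-lift (lift ∘ root) (connect x y r) (cong lift r)

        connect′ : ∀ x y → root′ x ≡ root′ y → Trail (e ∷ es) potential′ x y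
        connect′ x y r′ with root x ≟ root t | root y ≟ root t
        ... | yes x~t | yes y~t = trail-weaken (lifted x y (trans x~t (sym y~t)))
        ... | no _    | no _    = trail-weaken (lifted x y r′)
        ... | yes x~t | no _    = trail-bridge s↑ e∉es (lifted x t x~t) merged↑ (lifted c₀ y r′) x~t (c₀≁t ∘ sym)
        ... | no _    | yes y~t = trail-bridge s↓ e∉es (lifted x c₀ r′) merged↓ (lifted t y (sym y~t)) r′ c₀≁t

        merging : PartialPotential (e ∷ es)
        merging = record
          { potential      = potential′
          ; root           = root′
          ; potential-step = extendConsistent shifted-step merged↓
          ; root-step      = extendRoot relabelled-step (trans ifMoved-c₀ (sym ifMoved-t))
          ; connect        = connect′
          }

    extend : PartialPotential (e ∷ es)
    extend with any? (λ t → e ∈? premises (link t))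
      where open import Data.List.Membership.DecPropositional (_≟_ {nEdges}) using (_∈?_)
    ... | no noPremise = pending noPremise
    ... | yes (t , e∈t) with root (source N e) ≟ root t
    ...   | yes c₀~t = closing e∈t c₀~t
    ...   | no  c₀≁t = Merge.merging e∈t c₀≁t

  partialPotential : (∀ c → cycleWeight c ≡ 0ℤ) → ∀ es → Unique es → PartialPotential es
  partialPotential zeroCycles []       _                = noEdges
  partialPotential zeroCycles (e ∷ es) e∷es-distinct@(_ ∷ distinct) =
    Extend.extend zeroCycles (Uniqueₚ.Unique[x∷xs]⇒x∉xs e∷es-distinct) (partialPotential zeroCycles es distinct)

  cycleWeight≡0⇒potential : (∀ c → cycleWeight c ≡ 0ℤ) → ∃ IsPotential
  cycleWeight≡0⇒potential zeroCycles = potential , λ s → potential-step s (∈-allFin (stepEdge N s))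
    where open PartialPotential (partialPotential zeroCycles (allFin nEdges) (Uniqueₚ.allFin⁺ nEdges))

module Balance (N : Net) where
  open Net N

  -- The premise of a paragraph link sits one index above its conclusion.
  paragraphOffset : LinkKind → Dir N → ℤ
  paragraphOffset paraK up = 1ℤ
  paragraphOffset _     _  = 0ℤ

  portOffset : Fin nLinks → Dir N → ℤ
  portOffset l = paragraphOffset (kindOf (link l))

  open PortWeighting N portOffset public

  minusAt-plusAt : ∀ m d d' →
    + minusAt N m d d' - + plusAt N m d d' ≡ portOffset m d' - portOffset m (flip N d)
  -- Both sides split on the kind first, so for kinds other than paraK they reduce to 0 for all d d'.
  minusAt-plusAt m d d' with kindOf (link m) | d | d'
  ... | paraK     | down | down = refl
  ... | paraK     | down | up   = refl
  ... | paraK     | up   | down = refl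
  ... | paraK     | up   | up   = refl
  ... | axK       | _    | _    = refl
  ... | cutK      | _    | _    = refl
  ... | oneK      | _    | _    = refl
  ... | botK      | _    | _    = refl
  ... | tensorK   | _    | _    = refl
  ... | parK      | _    | _    = refl
  ... | flatK     | _    | _    = refl
  ... | paxK      | _    | _    = refl
  ... | whynotK   | _    | _    = refl
  ... | ofcourseK | _    | _    = refl

  countWalk-difference : ∀ {m b} d (p : Walk N m b) d₀ →
    + countWalk N (minusAt N) d p d₀ - + countWalk N (plusAt N) d p d₀
      ≡ walkWeight p + (portOffset b d₀ - portOffset m (flip N d))
  countWalk-difference {m} d [] d₀ = trans (minusAt-plusAt m d d₀) (sym (ℤₚ.+-identityˡ _))
  countWalk-difference {m} {b} d (_∷_ {m = m'} s p) d₀ = begin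
    + (μ ℕ.+ M) - + (π ℕ.+ Π)
      ≡⟨ cong₂ _-_ (ℤₚ.pos-+ μ M) (ℤₚ.pos-+ π Π) ⟩
    (+ μ + + M) - (+ π + + Π)
      ≡⟨ regroup (+ μ) (+ M) (+ π) (+ Π) ⟩
    (+ μ - + π) + (+ M - + Π)
      ≡⟨ cong₂ _+_ (minusAt-plusAt m d dₛ) (countWalk-difference dₛ p d₀) ⟩
    (portOffset m dₛ - portOffset m (flip N d)) + (walkWeight p + (portOffset b d₀ - portOffset m' (flip N dₛ)))
      ≡⟨ identity (portOffset m dₛ) (portOffset m (flip N d)) (walkWeight p) (portOffset b d₀) (portOffset m' (flip N dₛ)) ⟩
    walkWeight (s ∷ p) + (portOffset b d₀ - portOffset m (flip N d))
      ∎
    where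
    open ≡-Reasoning
    dₛ : Dir N
    dₛ = stepDir N s
    μ π M Π : ℕ
    μ = minusAt N m d dₛ
    π = plusAt N m d dₛ
    M = countWalk N (minusAt N) dₛ p d₀
    Π = countWalk N (plusAt N) dₛ p d₀
    regroup : ∀ a b c d → (a + b) - (c + d) ≡ (a - c) + (b - d)
    regroup = solve-∀
    identity : ∀ a b c d e → (a - b) + (c + (d - e)) ≡ ((a - e) + c) + (d - b)
    identity = solve-∀

  balance≡cycleWeight : (c : Cycle N) → + nMinus N c - + nPlus N c ≡ cycleWeight c
  balance≡cycleWeight (cycle s p _) =
    trans (countWalk-difference (stepDir N s) p (stepDir N s)) (ℤₚ.+-comm (walkWeight p) (stepWeight s))

  balanced⇔cycleWeight≡0 : (c : Cycle N) → Balanced N c ⇔ (cycleWeight c ≡ 0ℤ)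
  balanced⇔cycleWeight≡0 c = mk⇔
    (λ balanced → trans (sym (balance≡cycleWeight c)) (ℤₚ.i≡j⇒i-j≡0 (cong +_ (sym balanced))))
    (λ weightless → sym (ℤₚ.+-injective (ℤₚ.i-j≡0⇒i≡j _ _ (trans (balance≡cycleWeight c) weightless))))

  AtLevel : (Fin nEdges → ℤ) → Link (Fin nEdges) → ℤ → Set
  AtLevel I L v = ∀ d → All (λ e → I e ≡ v + paragraphOffset (kindOf L) d) (ports N L d)

  indexCond⇒atLevel : ∀ I L → IndexCond N I L → ∃ (AtLevel I L)
  indexCond⇒atLevel I (ax a b)       a≡b       = I a , λ { down → ≡⇒≡+0 refl ∷ ≡⇒≡+0 (sym a≡b) ∷ [] ; up → [] }
  indexCond⇒atLevel I (cut a b)      a≡b       = I a , λ { down → [] ; up → ≡⇒≡+0 refl ∷ ≡⇒≡+0 (sym a≡b) ∷ [] }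
  indexCond⇒atLevel I (one c)        _         = I c , λ { down → ≡⇒≡+0 refl ∷ [] ; up → [] }
  indexCond⇒atLevel I (bot c)        _         = I c , λ { down → ≡⇒≡+0 refl ∷ [] ; up → [] }
  indexCond⇒atLevel I (tensor a b c) (a≡c , b≡c) =
    I c , λ { down → ≡⇒≡+0 refl ∷ [] ; up → ≡⇒≡+0 a≡c ∷ ≡⇒≡+0 b≡c ∷ [] }
  indexCond⇒atLevel I (par a b c)    (a≡c , b≡c) =
    I c , λ { down → ≡⇒≡+0 refl ∷ [] ; up → ≡⇒≡+0 a≡c ∷ ≡⇒≡+0 b≡c ∷ [] }
  indexCond⇒atLevel I (flat a c)     a≡c       = I c , λ { down → ≡⇒≡+0 refl ∷ [] ; up → ≡⇒≡+0 a≡c ∷ [] }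
  indexCond⇒atLevel I (pax a c)      a≡c       = I c , λ { down → ≡⇒≡+0 refl ∷ [] ; up → ≡⇒≡+0 a≡c ∷ [] }
  indexCond⇒atLevel I (whynot ps c)  ps≡c      = I c , λ { down → ≡⇒≡+0 refl ∷ [] ; up → All.map ≡⇒≡+0 ps≡c }
  indexCond⇒atLevel I (ofcourse a c) a≡c       = I c , λ { down → ≡⇒≡+0 refl ∷ [] ; up → ≡⇒≡+0 a≡c ∷ [] }
  indexCond⇒atLevel I (para a c)     a≡c+1     = I c , λ { down → ≡⇒≡+0 refl ∷ [] ; up → a≡c+1 ∷ [] }

  atLevel⇒indexCond : ∀ I L {v} → AtLevel I L v → IndexCond N I L
  atLevel⇒indexCond I (ax a b) h with h down
  ... | a≡v ∷ b≡v ∷ [] = trans a≡v (sym b≡v)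
  atLevel⇒indexCond I (cut a b) h with h up
  ... | a≡v ∷ b≡v ∷ [] = trans a≡v (sym b≡v)
  atLevel⇒indexCond I (one c) h = tt
  atLevel⇒indexCond I (bot c) h = tt
  atLevel⇒indexCond I (tensor a b c) h with h up | h down
  ... | a≡v ∷ b≡v ∷ [] | c≡v ∷ [] = trans a≡v (sym c≡v) , trans b≡v (sym c≡v)
  atLevel⇒indexCond I (par a b c) h with h up | h down
  ... | a≡v ∷ b≡v ∷ [] | c≡v ∷ [] = trans a≡v (sym c≡v) , trans b≡v (sym c≡v)
  atLevel⇒indexCond I (flat a c) h with h up | h down
  ... | a≡v ∷ [] | c≡v ∷ [] = trans a≡v (sym c≡v)
  atLevel⇒indexCond I (pax a c) h with h up | h down
  ... | a≡v ∷ [] | c≡v ∷ [] = trans a≡v (sym c≡v)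
  atLevel⇒indexCond I (whynot ps c) h with h down
  ... | c≡v ∷ [] = All.map (λ p≡v → trans p≡v (sym c≡v)) (h up)
  atLevel⇒indexCond I (ofcourse a c) h with h up | h down
  ... | a≡v ∷ [] | c≡v ∷ [] = trans a≡v (sym c≡v)
  atLevel⇒indexCond I (para a c) {v} h with h up | h down
  ... | a≡v+1 ∷ [] | c≡v ∷ [] = trans a≡v+1 (cong (_+ 1ℤ) (trans (sym (ℤₚ.+-identityʳ v)) (sym c≡v)))

  indexing⇒potential : Indexable N → ∃ IsPotential
  indexing⇒potential (I , isIndexing) = level , potential
    where
    atLevel : ∀ l → ∃ (AtLevel I (link l))
    atLevel l = indexCond⇒atLevel I (link l) (isIndexing l)

    level : Fin nLinks → ℤ
    level l = proj₁ (atLevel l)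

    difference : ∀ a b x y {i} → i ≡ a + x → i ≡ b + y → b ≡ a + (x - y)
    difference a b x y refl a+x≡b+y = begin
      b                 ≡⟨ identity b y ⟩
      (b + y) - y       ≡⟨ cong (_- y) a+x≡b+y ⟨
      (a + x) - y       ≡⟨ ℤₚ.+-assoc a x (ℤ.- y) ⟩
      a + (x - y)       ∎
      where
      open ≡-Reasoning
      identity : ∀ b y → b ≡ (b + y) - y
      identity = solve-∀

    potential : IsPotential level
    potential {l} {l'} s with step-ports N s
    ... | e∈l , e∈l' =
      difference (level l) (level l') (portOffset l (stepDir N s)) (portOffset l' (flip N (stepDir N s)))
        (All.lookup (proj₂ (atLevel l) (stepDir N s)) e∈l)
        (All.lookup (proj₂ (atLevel l') (flip N (stepDir N s))) e∈l')

  potential⇒indexable : ∃ IsPotential → Indexable N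
  potential⇒indexable (P , potential) = I , λ l → atLevel⇒indexCond I (link l) {P l} (atLevel l)
    where
    I : Fin nEdges → ℤ
    I e = P (source N e) + portOffset (source N e) down

    raise : ∀ a b x y → b ≡ a + (x - y) → a + x ≡ b + y
    raise a _ x y refl = identity a x y
      where identity : ∀ a x y → a + x ≡ (a + (x - y)) + y
            identity = solve-∀

    atLevel : ∀ l → AtLevel I (link l) (P l)
    atLevel l down = All.tabulate λ e∈l → cong (λ m → P m + portOffset m down) (sym (source-unique N e∈l))
    atLevel l up   = All.tabulate λ {e} e∈l →
      raise (P (source N e)) (P l) (portOffset (source N e) down) (portOffset l up)
        (potential (stepDown e (source-conclusion N e) e∈l))

mainTheorem9 : (N : Net) → Indexable N ⇔ ((c : Cycle N) → Balanced N c)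
mainTheorem9 N = mk⇔
  (λ indexable c → Equivalence.from (balanced⇔cycleWeight≡0 c)
                     (potential⇒cycleWeight≡0 (proj₂ (indexing⇒potential indexable)) c))
  (λ balanced → potential⇒indexable (cycleWeight≡0⇒potential λ c →
                  Equivalence.to (balanced⇔cycleWeight≡0 c) (balanced c)))
  where open Balance N
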